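{- Let $P$ be a nested program in which $\neg$ does not occur. For any consistent sets of literals $X,Y$ with $X\subseteq Y$, $(X,Y)$ is an SE-model of $P$ if and only if $(X^+,Y^+)$ is an SE-model of $P$, where $Z^+$ denotes the set of atoms belonging to $Z$.
   Context: Fix a set of propositional atoms. A literal is an atom $A$ or its classical negation $\neg A$; a set of literals is consistent if it does not contain both $A$ and $\neg A$. Elementary formulas are literals and $\bot$, $\top$. Formulas are built from elementary formulas using the unary connective $\mathit{not}$ and binary connectives "$,$" (conjunction) and "$;$" (disjunction). A rule is $F\leftarrow G$ with formulas $F,G$; a nested program is a set of rules. For consistent $X$: for elementary $F$, $X\models F$ iff $F\in X$ or $F=\top$; $X\models(F,G)$ iff both; $X\models(F;G)$ iff either; $X\models\mathit{not}\,F$ iff $X\not\models F$. $X$ satisfies $F\leftarrow G$ if $X\models G$ implies $X\models F$; $X$ satisfies a program if it satisfies all its rules. The reduct $F^X$ replaces each maximal occurrence of a subformula $\mathit{not}\,G$ by $\bot$ if $X\models G$ and by $\top$ otherwise; $P^X$ replaces head and body of each rule by their reducts. For consistent sets $X\subseteq Y$, $(X,Y)$ is an SE-model of $P$ if $Y\models P$ and $X\models P^Y$. -}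

module Defs where

open import Data.Bool using (Bool; true; false; not; _∧_; _∨_; if_then_else_)
open import Data.Product using (_×_; _,_)
open import Data.Empty using (⊥)
open import Data.Unit using (⊤)
open import Relation.Nullary using (¬_)
open import Relation.Binary.PropositionalEquality using (_≡_)

module _ (Atom : Set) where

  -- literals: an atom A or its classical negation ¬A
  data Literal : Set where
    pos : Atom → Literal
    neg : Atom → Literal

  LitSet : Set
  LitSet = Literal → Bool

  _∈ₗ_ : Literal → LitSet → Set
  l ∈ₗ X = X l ≡ true

  _⊆ₗ_ : LitSet → LitSet → Set
  X ⊆ₗ Y = ∀ l → l ∈ₗ X → l ∈ₗ Y

  Consistent : LitSet → Set
  Consistent X = ∀ A → ¬ (pos A ∈ₗ X × neg A ∈ₗ X)

  _⁺ : LitSet → LitSet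
  (Z ⁺) (pos A) = Z (pos A)
  (Z ⁺) (neg A) = false

  data Formula : Set where
    lit  : Literal → Formula
    ⊥f   : Formula
    ⊤f   : Formula
    notf : Formula → Formula
    _∧f_ : Formula → Formula → Formula
    _∨f_ : Formula → Formula → Formula

  record Rule : Set where
    constructor _←_
    field
      head : Formula
      body : Formula

  Program : Set₁
  Program = Rule → Set

  -- satisfaction (Boolean-valued, since sets are decidable)
  sat : LitSet → Formula → Bool
  sat X (lit l)    = X l
  sat X ⊥f         = false
  sat X ⊤f         = true
  sat X (notf F)   = not (sat X F)
  sat X (F ∧f G)   = sat X F ∧ sat X G
  sat X (F ∨f G)   = sat X F ∨ sat X G

  _⊨_ : LitSet → Formula → Set
  X ⊨ F = sat X F ≡ true

  _⊨r_ : LitSet → Rule → Set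
  X ⊨r (F ← G) = X ⊨ G → X ⊨ F

  _⊨P_ : LitSet → Program → Set
  X ⊨P P = ∀ r → P r → X ⊨r r

  reduct : Formula → LitSet → Formula
  reduct (lit l)  X = lit l
  reduct ⊥f       X = ⊥f
  reduct ⊤f       X = ⊤f
  reduct (notf G) X = if sat X G then ⊥f else ⊤f
  reduct (F ∧f G) X = reduct F X ∧f reduct G X
  reduct (F ∨f G) X = reduct F X ∨f reduct G X

  reductRule : Rule → LitSet → Rule
  reductRule (F ← G) X = reduct F X ← reduct G X

  -- P^X = { r^X | r ∈ P }; satisfying P^X means satisfying r^X for each r ∈ P
  _⊨P^_ : LitSet → LitSet → Program → Set
  (X ⊨P^ Y) P = ∀ r → P r → X ⊨r reductRule r Y

  SEModel : Program → LitSet → LitSet → Set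
  SEModel P X Y = Consistent X × Consistent Y × X ⊆ₗ Y × Y ⊨P P × (X ⊨P^ Y) P

  NegFreeF : Formula → Set
  NegFreeF (lit (pos A)) = ⊤
  NegFreeF (lit (neg A)) = ⊥
  NegFreeF ⊥f            = ⊤
  NegFreeF ⊤f            = ⊤
  NegFreeF (notf F)      = NegFreeF F
  NegFreeF (F ∧f G)      = NegFreeF F × NegFreeF G
  NegFreeF (F ∨f G)      = NegFreeF F × NegFreeF G

  NegFreeProgram : Program → Set
  NegFreeProgram P = ∀ F G → P (F ← G) → NegFreeF F × NegFreeF G

{-# OPTIONS --safe #-}
module Submission where

-- Without classical negation a formula only inspects positive literals, on which Z and Z⁺
-- agree; and the reduct only consults the truth of negated subformulas, so F^(Y⁺) = F^Y,
-- which is again ¬-free. Hence both halves of the SE-condition transfer rule by rule, while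
-- Z⁺ is always consistent and ⁺ is monotone.

open import Defs
open import Data.Bool using (true; false; not; _∧_; _∨_; if_then_else_)
open import Data.Product using (_×_; _,_)
open import Data.Unit using (tt)
open import Function.Base using (id)
open import Function.Bundles using (_⇔_; mk⇔; Equivalence)
open import Function.Related.TypeIsomorphisms using (→-cong-⇔)
open import Relation.Binary.PropositionalEquality using (_≡_; refl; sym; cong; cong₂; subst)

∀∈-cong-⇔ : {R : Set} {P : R → Set} {S T : R → Set} →
            (∀ r → P r → S r ⇔ T r) → (∀ r → P r → S r) ⇔ (∀ r → P r → T r)
∀∈-cong-⇔ S⇔T = mk⇔ (λ s r p → Equivalence.to (S⇔T r p) (s r p))
                     (λ t r p → Equivalence.from (S⇔T r p) (t r p))

module _ {Atom : Set} where

  ⁺-consistent : (Z : LitSet Atom) → Consistent Atom (_⁺ Atom Z)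
  ⁺-consistent Z a (_ , ())

  ⁺-mono : {X Y : LitSet Atom} → _⊆ₗ_ Atom X Y → _⊆ₗ_ Atom (_⁺ Atom X) (_⁺ Atom Y)
  ⁺-mono X⊆Y (pos a) = X⊆Y (pos a)
  ⁺-mono X⊆Y (neg a) ()

  sat-⁺ : (Z : LitSet Atom) (F : Formula Atom) → NegFreeF Atom F →
          sat Atom (_⁺ Atom Z) F ≡ sat Atom Z F
  sat-⁺ Z (lit (pos a)) _         = refl
  sat-⁺ Z ⊥f            _         = refl
  sat-⁺ Z ⊤f            _         = refl
  sat-⁺ Z (notf F)      nF        = cong not (sat-⁺ Z F nF)
  sat-⁺ Z (F ∧f G)      (nF , nG) = cong₂ _∧_ (sat-⁺ Z F nF) (sat-⁺ Z G nG)
  sat-⁺ Z (F ∨f G)      (nF , nG) = cong₂ _∨_ (sat-⁺ Z F nF) (sat-⁺ Z G nG)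

  reduct-⁺ : (F : Formula Atom) (Y : LitSet Atom) → NegFreeF Atom F →
             reduct Atom F (_⁺ Atom Y) ≡ reduct Atom F Y
  reduct-⁺ (lit (pos a)) Y _         = refl
  reduct-⁺ ⊥f            Y _         = refl
  reduct-⁺ ⊤f            Y _         = refl
  reduct-⁺ (notf F)      Y nF        = cong (if_then ⊥f else ⊤f) (sat-⁺ Y F nF)
  reduct-⁺ (F ∧f G)      Y (nF , nG) = cong₂ _∧f_ (reduct-⁺ F Y nF) (reduct-⁺ G Y nG)
  reduct-⁺ (F ∨f G)      Y (nF , nG) = cong₂ _∨f_ (reduct-⁺ F Y nF) (reduct-⁺ G Y nG)

  reduct-negFree : (F : Formula Atom) (Y : LitSet Atom) → NegFreeF Atom F →
                   NegFreeF Atom (reduct Atom F Y)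
  reduct-negFree (lit (pos a)) Y _ = tt
  reduct-negFree ⊥f            Y _ = tt
  reduct-negFree ⊤f            Y _ = tt
  reduct-negFree (notf F)      Y _ with sat Atom Y F
  ... | true  = tt
  ... | false = tt
  reduct-negFree (F ∧f G) Y (nF , nG) = reduct-negFree F Y nF , reduct-negFree G Y nG
  reduct-negFree (F ∨f G) Y (nF , nG) = reduct-negFree F Y nF , reduct-negFree G Y nG

  NegFreeRule : Rule Atom → Set
  NegFreeRule (F ← G) = NegFreeF Atom F × NegFreeF Atom G

  NegFreeProgram⇒NegFreeRule : {P : Program Atom} → NegFreeProgram Atom P →
                               ∀ r → P r → NegFreeRule r
  NegFreeProgram⇒NegFreeRule nfP (F ← G) = nfP F G

  ⊨-⁺ : (Z : LitSet Atom) (F : Formula Atom) → NegFreeF Atom F →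
        _⊨_ Atom (_⁺ Atom Z) F ⇔ _⊨_ Atom Z F
  ⊨-⁺ Z F nF rewrite sat-⁺ Z F nF = mk⇔ id id

  ⊨r-⁺ : (Z : LitSet Atom) (r : Rule Atom) → NegFreeRule r →
         _⊨r_ Atom (_⁺ Atom Z) r ⇔ _⊨r_ Atom Z r
  ⊨r-⁺ Z (F ← G) (nF , nG) = →-cong-⇔ (⊨-⁺ Z G nG) (⊨-⁺ Z F nF)

  reductRule-⁺ : (r : Rule Atom) (Y : LitSet Atom) → NegFreeRule r →
                 reductRule Atom r (_⁺ Atom Y) ≡ reductRule Atom r Y
  reductRule-⁺ (F ← G) Y (nF , nG) = cong₂ _←_ (reduct-⁺ F Y nF) (reduct-⁺ G Y nG)

  reductRule-negFree : (r : Rule Atom) (Y : LitSet Atom) → NegFreeRule r →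
                       NegFreeRule (reductRule Atom r Y)
  reductRule-negFree (F ← G) Y (nF , nG) = reduct-negFree F Y nF , reduct-negFree G Y nG

  ⊨r-reduct-⁺ : (X Y : LitSet Atom) (r : Rule Atom) → NegFreeRule r →
                _⊨r_ Atom (_⁺ Atom X) (reductRule Atom r (_⁺ Atom Y)) ⇔
                _⊨r_ Atom X (reductRule Atom r Y)
  ⊨r-reduct-⁺ X Y r nr =
    subst (λ r′ → _⊨r_ Atom (_⁺ Atom X) r′ ⇔ _⊨r_ Atom X (reductRule Atom r Y))
          (sym (reductRule-⁺ r Y nr))
          (⊨r-⁺ X (reductRule Atom r Y) (reductRule-negFree r Y nr))

  ⊨P-⁺ : (Z : LitSet Atom) {P : Program Atom} → NegFreeProgram Atom P →
         _⊨P_ Atom (_⁺ Atom Z) P ⇔ _⊨P_ Atom Z P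
  ⊨P-⁺ Z nfP = ∀∈-cong-⇔ (λ r p → ⊨r-⁺ Z r (NegFreeProgram⇒NegFreeRule nfP r p))

  ⊨P^-⁺ : (X Y : LitSet Atom) {P : Program Atom} → NegFreeProgram Atom P →
          _⊨P^_ Atom (_⁺ Atom X) (_⁺ Atom Y) P ⇔ _⊨P^_ Atom X Y P
  ⊨P^-⁺ X Y nfP = ∀∈-cong-⇔ (λ r p → ⊨r-reduct-⁺ X Y r (NegFreeProgram⇒NegFreeRule nfP r p))

lemma3 : (Atom : Set) (P : Program Atom) → NegFreeProgram Atom P →
           (X Y : LitSet Atom) → Consistent Atom X → Consistent Atom Y → _⊆ₗ_ Atom X Y →
           SEModel Atom P X Y ⇔ SEModel Atom P (_⁺ Atom X) (_⁺ Atom Y)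
lemma3 Atom P nfP X Y cX cY X⊆Y = mk⇔
  (λ (_ , _ , _ , Y⊨P , X⊨Pʸ) →
     ⁺-consistent X , ⁺-consistent Y , ⁺-mono X⊆Y ,
     from (⊨P-⁺ Y nfP) Y⊨P , from (⊨P^-⁺ X Y nfP) X⊨Pʸ)
  (λ (_ , _ , _ , Y⁺⊨P , X⁺⊨Pʸ⁺) →
     cX , cY , X⊆Y , to (⊨P-⁺ Y nfP) Y⁺⊨P , to (⊨P^-⁺ X Y nfP) X⁺⊨Pʸ⁺)
  where open Equivalence
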